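{- For all positive integers $A$, $B$ and $N$, $$\sum_{j=1}^{N-1} j^{A\lambda(N)} \equiv \sum_{j=1}^{N-1} j^{B\phi(N)} \pmod{N}.$$
   Context: $\phi$ denotes Euler's totient function and $\lambda$ denotes Carmichael's function: $\lambda(N)$ is the smallest positive integer $m$ such that $a^m\equiv 1 \pmod N$ for every integer $a$ coprime to $N$. -}

module Defs where

open import Data.Nat using (ℕ; zero; suc; _+_; _*_; _^_; _≤_; _<_; NonZero)
open import Data.Nat.DivMod using (_%_)
open import Data.Nat.Coprimality using (Coprime; coprime?)
open import Data.Nat.ListAction using (sum)
open import Data.List using (List; map; filter; length; applyUpTo)
open import Data.Product using (_×_)
open import Relation.Binary.PropositionalEquality using (_≡_)

_≡_[mod_] : ℕ → ℕ → (N : ℕ) → .{{NonZero N}} → Set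
a ≡ b [mod N ] = a % N ≡ b % N

oneTo : ℕ → List ℕ
oneTo n = applyUpTo suc n

φ : ℕ → ℕ
φ N = length (filter (λ k → coprime? k N) (oneTo N))

KillsUnits : (N : ℕ) → .{{NonZero N}} → ℕ → Set
KillsUnits N m = ∀ (a : ℕ) → Coprime a N → (a ^ m) ≡ 1 [mod N ]

IsCarmichael : (N : ℕ) → .{{NonZero N}} → ℕ → Set
IsCarmichael N m =
  (1 ≤ m) × KillsUnits N m × (∀ k → 1 ≤ k → KillsUnits N k → m ≤ k)

sumTo : ℕ → (ℕ → ℕ) → ℕ
sumTo n f = sum (map f (oneTo n))

module Submission where

-- Write S(e) = Σ_{j=1}^{N−1} j^e and λ = λ(N).  By Euler's theorem B·φ(N) is
-- an exponent of the unit group modulo N, so λ ∣ B·φ(N) = q·λ with q ≥ 1, and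
-- it suffices to show S(A·λ) ≡ S(2·λ) (mod N) for every A ≥ 1.  Two facts give
-- this.  (i) If d² ∣ N then d ∣ λ (expand (1 + N/d)^λ modulo N); hence a factor
-- i^(e+1) ∣ N with i ≥ 2 and e ≥ λ is impossible, except for e = λ = 2 with
-- 8 ∣ N.  (ii) If N has no (e+1)-th power factor, then j^(e+k) ≡ j^e (mod N)
-- for every j and every unit exponent k (split N = N′·gcd(N, j^e), N′ ⊥ j).
-- The exception A = 1, λ = 2, 8 ∣ N forces N ∈ {8, 24}, checked by computation.

open import Defs
open import Data.Nat using (ℕ; _*_; _^_; _∸_; _≤_; NonZero)
open import Data.Nat.Base using (zero; suc; _+_; _<_; z≤n; s≤s; s≤s⁻¹; >-nonZero; ≢-nonZero; ≢-nonZero⁻¹)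
open import Data.Nat.Properties
open import Data.Nat.DivMod using (_%_; _/_; m≡m%n+[m/n]*n; [m+kn]%n≡m%n; m%n<n; m<n⇒m%n≡m)
open import Data.Nat.Divisibility
open import Data.Nat.Coprimality using (Coprime; coprime?; coprime-divisor; coprime-+; 1-coprimeTo; coprime-Bézout)
open import Data.Nat.GCD using (gcd; gcd[m,n]∣m; gcd[m,n]∣n; gcd-greatest; module Bézout)
import Data.Nat.Coprimality as Coprime
open import Data.Nat.ListAction using (sum)
open import Data.Nat.Tactic.RingSolver using (solve-∀; solve)
open import Data.List using ([]; _∷_; [_]; _∷ʳ_; map; filter; length; applyUpTo)
open import Data.List.Properties using (map-applyUpTo; applyUpTo-∷ʳ; filter-accept)
open import Data.Nat.ListAction.Properties using (sum-++)
open import Data.Fin using (Fin; toℕ; fromℕ<)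
import Data.Fin as Fin
open import Data.Fin.Properties using (toℕ-injective; toℕ-fromℕ<; toℕ<n)
open import Data.Fin.Permutation using (Permutation; permutation)
open import Relation.Nullary using (Dec; yes; no; ¬_)
open import Relation.Nullary.Decidable using (_×-dec_)
open import Relation.Unary using (Decidable)
open import Function using (_∘_)
open import Algebra.Properties.CommutativeMonoid.Sum *-1-commutativeMonoid
  using () renaming (sum to ∏; sum-permute to ∏-permute; sum-cong-≗ to ∏-cong)
open import Data.Product using (∃; ∃₂; _×_; _,_; proj₁; proj₂)
open import Data.Sum using (_⊎_; inj₁; inj₂)
open import Data.Empty using (⊥; ⊥-elim)
open import Level using (0ℓ)
open import Relation.Binary.Bundles using (Setoid)
open import Relation.Binary.Structures using (IsEquivalence)
open import Relation.Binary.PropositionalEquality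
  using (_≡_; _≢_; refl; sym; trans; cong; cong₂; subst; subst₂; module ≡-Reasoning)
import Relation.Binary.Reasoning.Setoid as SetoidReasoning

-- x ≈ y ⟨mod n ⟩: x and y differ by a multiple of n.
infix 4 _≈_⟨mod_⟩
_≈_⟨mod_⟩ : ℕ → ℕ → ℕ → Set
x ≈ y ⟨mod n ⟩ = ∃₂ λ a b → x + a * n ≡ y + b * n

module _ {n : ℕ} where

  ≈-refl : ∀ {x} → x ≈ x ⟨mod n ⟩
  ≈-refl = 0 , 0 , refl

  ≈-sym : ∀ {x y} → x ≈ y ⟨mod n ⟩ → y ≈ x ⟨mod n ⟩
  ≈-sym (a , b , eq) = b , a , sym eq

  ≈-trans : ∀ {x y z} → x ≈ y ⟨mod n ⟩ → y ≈ z ⟨mod n ⟩ → x ≈ z ⟨mod n ⟩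
  ≈-trans {x} {y} {z} (a , b , p) (c , d , q) = a + c , d + b , (begin
    x + (a + c) * n      ≡⟨ shuffle x a c ⟩
    (x + a * n) + c * n  ≡⟨ cong (_+ c * n) p ⟩
    (y + b * n) + c * n  ≡⟨ swap y b c ⟩
    (y + c * n) + b * n  ≡⟨ cong (_+ b * n) q ⟩
    (z + d * n) + b * n  ≡⟨ sym (shuffle z d b) ⟩
    z + (d + b) * n      ∎)
    where
    open ≡-Reasoning
    shuffle : ∀ u s t → u + (s + t) * n ≡ (u + s * n) + t * n
    shuffle u s t = solve (u ∷ s ∷ t ∷ n ∷ [])
    swap : ∀ u s t → (u + s * n) + t * n ≡ (u + t * n) + s * n
    swap u s t = solve (u ∷ s ∷ t ∷ n ∷ [])

  ≈-isEquivalence : IsEquivalence (λ x y → x ≈ y ⟨mod n ⟩)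
  ≈-isEquivalence = record { refl = ≈-refl ; sym = ≈-sym ; trans = ≈-trans }

≈-setoid : ℕ → Setoid 0ℓ 0ℓ
≈-setoid n = record { isEquivalence = ≈-isEquivalence {n} }

module ≈-Reasoning (n : ℕ) = SetoidReasoning (≈-setoid n)

module _ {n : ℕ} where

  ≈-+ : ∀ {x x′ y y′} → x ≈ x′ ⟨mod n ⟩ → y ≈ y′ ⟨mod n ⟩ → x + y ≈ x′ + y′ ⟨mod n ⟩
  ≈-+ {x} {x′} {y} {y′} (a , b , p) (c , d , q) = a + c , b + d , (begin
    x + y + (a + c) * n          ≡⟨ interchange x y a c ⟩
    (x + a * n) + (y + c * n)    ≡⟨ cong₂ _+_ p q ⟩
    (x′ + b * n) + (y′ + d * n)  ≡⟨ sym (interchange x′ y′ b d) ⟩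
    x′ + y′ + (b + d) * n        ∎)
    where
    open ≡-Reasoning
    interchange : ∀ u v s t → u + v + (s + t) * n ≡ (u + s * n) + (v + t * n)
    interchange u v s t = solve (u ∷ v ∷ s ∷ t ∷ n ∷ [])

  ≈-divisor : ∀ {m x y} → n ∣ m → x ≈ y ⟨mod m ⟩ → x ≈ y ⟨mod n ⟩
  ≈-divisor {x = x} {y} (divides q refl) (a , b , p) = a * q , b * q , (begin
    x + a * q * n    ≡⟨ cong (x +_) (*-assoc a q n) ⟩
    x + a * (q * n)  ≡⟨ p ⟩
    y + b * (q * n)  ≡⟨ cong (y +_) (*-assoc b q n) ⟨
    y + b * q * n    ∎)
    where open ≡-Reasoning

  ≈-scale : ∀ c {x y} → x ≈ y ⟨mod n ⟩ → c * x ≈ c * y ⟨mod c * n ⟩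
  ≈-scale c {x} {y} (a , b , p) = a , b , (begin
    c * x + a * (c * n)  ≡⟨ distrib x a ⟩
    c * (x + a * n)      ≡⟨ cong (c *_) p ⟩
    c * (y + b * n)      ≡⟨ distrib y b ⟨
    c * y + b * (c * n)  ∎)
    where
    open ≡-Reasoning
    distrib : ∀ u s → c * u + s * (c * n) ≡ c * (u + s * n)
    distrib u s = solve (c ∷ u ∷ s ∷ n ∷ [])

  ≈-*ˡ : ∀ c {x y} → x ≈ y ⟨mod n ⟩ → c * x ≈ c * y ⟨mod n ⟩
  ≈-*ˡ c eq = ≈-divisor (n∣m*n c) (≈-scale c eq)

  ≈-* : ∀ {x x′ y y′} → x ≈ x′ ⟨mod n ⟩ → y ≈ y′ ⟨mod n ⟩ → x * y ≈ x′ * y′ ⟨mod n ⟩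
  ≈-* {x} {x′} {y} {y′} p q = begin
    x * y   ≈⟨ ≈-*ˡ x q ⟩
    x * y′  ≡⟨ *-comm x y′ ⟩
    y′ * x  ≈⟨ ≈-*ˡ y′ p ⟩
    y′ * x′ ≡⟨ *-comm y′ x′ ⟩
    x′ * y′ ∎
    where open ≈-Reasoning n

  ≈-^ : ∀ {x y} k → x ≈ y ⟨mod n ⟩ → x ^ k ≈ y ^ k ⟨mod n ⟩
  ≈-^ zero    eq = ≈-refl
  ≈-^ (suc k) eq = ≈-* eq (≈-^ k eq)

  ≈-sum : ∀ (f g : ℕ → ℕ) → (∀ j → f j ≈ g j ⟨mod n ⟩) →
          ∀ xs → sum (map f xs) ≈ sum (map g xs) ⟨mod n ⟩
  ≈-sum f g f≈g []       = ≈-refl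
  ≈-sum f g f≈g (x ∷ xs) = ≈-+ (f≈g x) (≈-sum f g f≈g xs)

  ∣⇒≈0 : ∀ {x} → n ∣ x → x ≈ 0 ⟨mod n ⟩
  ∣⇒≈0 (divides q refl) = 0 , q , +-identityʳ _

  ≈0⇒∣ : ∀ {x} → x ≈ 0 ⟨mod n ⟩ → n ∣ x
  ≈0⇒∣ {x} (a , b , p) = ∣m+n∣m⇒∣n (subst (n ∣_) (trans (sym p) (+-comm x (a * n))) (n∣m*n b)) (n∣m*n a)

  ≈-+-cancelˡ : ∀ x {y z} → x + y ≈ x + z ⟨mod n ⟩ → y ≈ z ⟨mod n ⟩
  ≈-+-cancelˡ x {y} {z} (a , b , p) =
    a , b , +-cancelˡ-≡ x _ _ (trans (sym (+-assoc x y _)) (trans p (+-assoc x z _)))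

  -- A factor coprime to the modulus can be cancelled: if y = x + t, then
  -- n divides t * c, hence t.
  ≈-*-cancelʳ-≤ : ∀ {c x y} → Coprime n c → x ≤ y → x * c ≈ y * c ⟨mod n ⟩ → x ≈ y ⟨mod n ⟩
  ≈-*-cancelʳ-≤ {c} {x} n⊥c x≤y xc≈yc with t , refl ← m≤n⇒∃[o]m+o≡n x≤y =
    subst (λ u → u ≈ x + t ⟨mod n ⟩) (+-identityʳ x) (≈-+ (≈-refl {x = x}) (≈-sym (∣⇒≈0 n∣t)))
    where
    xc+0≈xc+tc : x * c + 0 ≈ x * c + t * c ⟨mod n ⟩
    xc+0≈xc+tc = subst₂ (λ u v → u ≈ v ⟨mod n ⟩) (sym (+-identityʳ (x * c))) (*-distribʳ-+ c x t) xc≈yc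
    n∣t : n ∣ t
    n∣t = coprime-divisor n⊥c (subst (n ∣_) (*-comm t c) (≈0⇒∣ (≈-sym (≈-+-cancelˡ (x * c) xc+0≈xc+tc))))

  ≈-*-cancelʳ : ∀ {c x y} → Coprime n c → x * c ≈ y * c ⟨mod n ⟩ → x ≈ y ⟨mod n ⟩
  ≈-*-cancelʳ {x = x} {y} n⊥c xc≈yc with ≤-total x y
  ... | inj₁ x≤y = ≈-*-cancelʳ-≤ n⊥c x≤y xc≈yc
  ... | inj₂ y≤x = ≈-sym (≈-*-cancelʳ-≤ n⊥c y≤x (≈-sym xc≈yc))

module _ {n : ℕ} .{{_ : NonZero n}} where

  %-≈ : ∀ x → x % n ≈ x ⟨mod n ⟩
  %-≈ x = x / n , 0 , trans (sym (m≡m%n+[m/n]*n x n)) (sym (+-identityʳ x))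

  %⇒≈ : ∀ {x y} → x ≡ y [mod n ] → x ≈ y ⟨mod n ⟩
  %⇒≈ {x} {y} x%n≡y%n = ≈-trans (≈-sym (%-≈ x)) (subst (λ r → r ≈ y ⟨mod n ⟩) (sym x%n≡y%n) (%-≈ y))

  ≈⇒% : ∀ {x y} → x ≈ y ⟨mod n ⟩ → x ≡ y [mod n ]
  ≈⇒% {x} {y} (a , b , p) = begin
    x % n            ≡⟨ [m+kn]%n≡m%n x a n ⟨
    (x + a * n) % n  ≡⟨ cong (_% n) p ⟩
    (y + b * n) % n  ≡⟨ [m+kn]%n≡m%n y b n ⟩
    y % n            ∎
    where open ≡-Reasoning

  residue-≈ : ∀ {x y} → x < n → y < n → x ≈ y ⟨mod n ⟩ → x ≡ y
  residue-≈ x<n y<n x≈y = trans (sym (m<n⇒m%n≡m x<n)) (trans (≈⇒% x≈y) (m<n⇒m%n≡m y<n))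

coprime-*ʳ : ∀ {a b c} → Coprime a b → Coprime a c → Coprime a (b * c)
coprime-*ʳ {a} {b} {c} a⊥b a⊥c {i} (i∣a , i∣bc) = a⊥c (i∣a , coprime-divisor i⊥b i∣bc)
  where
  i⊥b : Coprime i b
  i⊥b (d∣i , d∣b) = a⊥b (∣-trans d∣i i∣a , d∣b)

coprime-^ʳ : ∀ {a b} k → Coprime a b → Coprime a (b ^ k)
coprime-^ʳ {a} zero    a⊥b = Coprime.sym (1-coprimeTo a)
coprime-^ʳ (suc k) a⊥b = coprime-*ʳ a⊥b (coprime-^ʳ k a⊥b)

coprime-∣ʳ : ∀ {a b d} → Coprime a b → d ∣ b → Coprime a d
coprime-∣ʳ a⊥b d∣b (i∣a , i∣d) = a⊥b (i∣a , ∣-trans i∣d d∣b)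

coprime-≈ : ∀ {n x y} → x ≈ y ⟨mod n ⟩ → Coprime x n → Coprime y n
coprime-≈ x≈y x⊥n {i} (i∣y , i∣n) =
  x⊥n (≈0⇒∣ (≈-trans (≈-divisor i∣n x≈y) (∣⇒≈0 i∣y)) , i∣n)

coprime-*⇒ʳ : ∀ a {k n} → Coprime (a * k) n → Coprime k n
coprime-*⇒ʳ a ak⊥n (i∣k , i∣n) = ak⊥n (∣n⇒∣m*n a i∣k , i∣n)

coprime-suc : ∀ y → Coprime (1 + y) y
coprime-suc y = subst (λ z → Coprime z y) (+-comm y 1) (coprime-+ (1-coprimeTo y))

coprime-odd : ∀ r → Coprime (1 + 2 * r) 2
coprime-odd r {i} (i∣1+2r , i∣2) =
  ∣1⇒≡1 (∣m+n∣m⇒∣n (subst (i ∣_) (+-comm 1 (2 * r)) i∣1+2r) (∣m⇒∣m*n r i∣2))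

^-distribʳ-* : ∀ x y k → (x * y) ^ k ≡ x ^ k * y ^ k
^-distribʳ-* x y zero    = refl
^-distribʳ-* x y (suc k) = begin
  x * y * (x * y) ^ k        ≡⟨ cong (x * y *_) (^-distribʳ-* x y k) ⟩
  x * y * (x ^ k * y ^ k)    ≡⟨ interchange x y (x ^ k) (y ^ k) ⟩
  x * x ^ k * (y * y ^ k)    ∎
  where
  open ≡-Reasoning
  interchange : ∀ p q r s → p * q * (r * s) ≡ p * r * (q * s)
  interchange = solve-∀

∏-≈ : ∀ {N} n (f g : Fin n → ℕ) → (∀ i → f i ≈ g i ⟨mod N ⟩) → ∏ f ≈ ∏ g ⟨mod N ⟩
∏-≈ zero    f g f≈g = ≈-refl
∏-≈ (suc n) f g f≈g = ≈-* (f≈g Fin.zero) (∏-≈ n (f ∘ Fin.suc) (g ∘ Fin.suc) (f≈g ∘ Fin.suc))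

∏-coprime : ∀ {N} n (f : Fin n → ℕ) → (∀ i → Coprime N (f i)) → Coprime N (∏ f)
∏-coprime {N} zero    f N⊥f = Coprime.sym (1-coprimeTo N)
∏-coprime     (suc n) f N⊥f = coprime-*ʳ (N⊥f Fin.zero) (∏-coprime n (f ∘ Fin.suc) (N⊥f ∘ Fin.suc))

∏-pow : ∀ a (h u : ℕ → ℕ) n →
        ∏ {n} (λ i → a ^ h (toℕ i) * u (toℕ i)) ≡ a ^ sum (applyUpTo h n) * ∏ {n} (u ∘ toℕ)
∏-pow a h u zero    = refl
∏-pow a h u (suc n) = begin
  a ^ h 0 * u 0 * ∏ {n} (λ i → a ^ h (suc (toℕ i)) * u (suc (toℕ i)))
    ≡⟨ cong (a ^ h 0 * u 0 *_) (∏-pow a (h ∘ suc) (u ∘ suc) n) ⟩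
  a ^ h 0 * u 0 * (a ^ H * U)
    ≡⟨ interchange (a ^ h 0) (u 0) (a ^ H) U ⟩
  a ^ h 0 * a ^ H * (u 0 * U)
    ≡⟨ cong (_* (u 0 * U)) (^-distribˡ-+-* a (h 0) H) ⟨
  a ^ (h 0 + H) * (u 0 * U) ∎
  where
  open ≡-Reasoning
  H = sum (applyUpTo (h ∘ suc) n)
  U = ∏ {n} (u ∘ suc ∘ toℕ)
  interchange : ∀ p q r s → p * q * (r * s) ≡ p * r * (q * s)
  interchange = solve-∀

indicator : ∀ {P : Set} → Dec P → ℕ
indicator (yes _) = 1
indicator (no _)  = 0

indicator-cong : ∀ {P Q : Set} (P? : Dec P) (Q? : Dec Q) → (P → Q) → (Q → P) → indicator P? ≡ indicator Q?
indicator-cong (yes _) (yes _)  P→Q Q→P = refl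
indicator-cong (no _)  (no _)   P→Q Q→P = refl
indicator-cong (yes p) (no ¬q)  P→Q Q→P = ⊥-elim (¬q (P→Q p))
indicator-cong (no ¬p) (yes q)  P→Q Q→P = ⊥-elim (¬p (Q→P q))

length-filter≡sum : ∀ {P : ℕ → Set} (P? : Decidable P) xs →
                    length (filter P? xs) ≡ sum (map (indicator ∘ P?) xs)
length-filter≡sum P? []       = refl
length-filter≡sum P? (x ∷ xs) with P? x
... | yes _ = cong suc (length-filter≡sum P? xs)
... | no _  = length-filter≡sum P? xs

sum-applyUpTo-shift : ∀ (f : ℕ → ℕ) n .{{_ : NonZero n}} → f 0 ≡ f n →
                      sum (applyUpTo (f ∘ suc) n) ≡ sum (applyUpTo f n)
sum-applyUpTo-shift f (suc m) f0≡fn = begin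
  sum (applyUpTo (f ∘ suc) (suc m))          ≡⟨ cong sum (applyUpTo-∷ʳ (f ∘ suc) m) ⟨
  sum (applyUpTo (f ∘ suc) m ∷ʳ f (suc m))   ≡⟨ sum-++ (applyUpTo (f ∘ suc) m) [ f (suc m) ] ⟩
  rest + (f (suc m) + 0)                     ≡⟨ cong (rest +_) (+-identityʳ (f (suc m))) ⟩
  rest + f (suc m)                           ≡⟨ +-comm rest (f (suc m)) ⟩
  f (suc m) + rest                           ≡⟨ cong (_+ rest) f0≡fn ⟨
  f 0 + rest                                 ∎
  where
  open ≡-Reasoning
  rest = sum (applyUpTo (f ∘ suc) m)

modular-inverse : ∀ {a N} .{{_ : NonZero N}} → Coprime a N → ∃ λ b → a * b ≈ 1 ⟨mod N ⟩
modular-inverse {a} {suc K} a⊥N with coprime-Bézout a⊥N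
... | Bézout.+- x y eq = x , 0 , y , trans (+-identityʳ (a * x)) (trans (*-comm a x) (sym eq))
... | Bézout.-+ x y eq = x * K , y , a * x , (begin
  a * (x * K) + y * suc K   ≡⟨ cong (a * (x * K) +_) eq ⟨
  a * (x * K) + (1 + x * a) ≡⟨ solve (a ∷ x ∷ K ∷ []) ⟩
  1 + a * x * suc K         ∎)
  where open ≡-Reasoning

-- Multiplication
-- by a permutes the residues 0..N−1, so the product P of the residues
-- coprime to N satisfies a^φ(N) · P ≡ P; and P is coprime to N.
module Euler {N : ℕ} .{{_ : NonZero N}} where

  ι : ℕ → ℕ
  ι k = indicator (coprime? k N)

  unit : ℕ → ℕ
  unit k = k ^ ι k

  ι-≈ : ∀ {x y} → x ≈ y ⟨mod N ⟩ → ι x ≡ ι y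
  ι-≈ {x} {y} x≈y = indicator-cong (coprime? x N) (coprime? y N) (coprime-≈ x≈y) (coprime-≈ (≈-sym x≈y))

  ι-*ˡ : ∀ a k → Coprime a N → ι (a * k) ≡ ι k
  ι-*ˡ a k a⊥N = indicator-cong (coprime? (a * k) N) (coprime? k N) (coprime-*⇒ʳ a)
    (λ k⊥N → Coprime.sym (coprime-*ʳ (Coprime.sym a⊥N) (Coprime.sym k⊥N)))

  unit-coprime : ∀ k → Coprime N (unit k)
  unit-coprime k with coprime? k N
  ... | yes k⊥N = coprime-^ʳ 1 (Coprime.sym k⊥N)
  ... | no _    = Coprime.sym (1-coprimeTo N)

  -- φ(N) counts 1..N; shifting to 0..N−1 is harmless because ι 0 = ι N.
  φ≡∑ι : φ N ≡ sum (applyUpTo ι N)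
  φ≡∑ι = begin
    φ N                               ≡⟨ length-filter≡sum (λ k → coprime? k N) (oneTo N) ⟩
    sum (map ι (applyUpTo suc N))     ≡⟨ cong sum (map-applyUpTo suc ι N) ⟩
    sum (applyUpTo (ι ∘ suc) N)       ≡⟨ sum-applyUpTo-shift ι N (ι-≈ {0} {N} (1 , 0 , refl)) ⟩
    sum (applyUpTo ι N)               ∎
    where open ≡-Reasoning

  mulBy : ℕ → Fin N → Fin N
  mulBy c i = fromℕ< (m%n<n (c * toℕ i) N)

  mulBy-inverse : ∀ c d → c * d ≈ 1 ⟨mod N ⟩ → ∀ i → mulBy c (mulBy d i) ≡ i
  mulBy-inverse c d cd≈1 i = toℕ-injective (residue-≈ (toℕ<n _) (toℕ<n i) (begin
    toℕ (mulBy c (mulBy d i))  ≡⟨ toℕ-fromℕ< _ ⟩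
    c * toℕ (mulBy d i) % N    ≈⟨ %-≈ _ ⟩
    c * toℕ (mulBy d i)        ≡⟨ cong (c *_) (toℕ-fromℕ< _) ⟩
    c * (d * toℕ i % N)        ≈⟨ ≈-*ˡ c (%-≈ _) ⟩
    c * (d * toℕ i)            ≡⟨ *-assoc c d (toℕ i) ⟨
    c * d * toℕ i              ≈⟨ ≈-* cd≈1 (≈-refl {x = toℕ i}) ⟩
    1 * toℕ i                  ≡⟨ *-identityˡ (toℕ i) ⟩
    toℕ i                      ∎))
    where open ≈-Reasoning N

  mulBy-permutation : ∀ {a} → Coprime a N → Permutation N N
  mulBy-permutation {a} a⊥N =
    permutation (mulBy a) (mulBy b) (mulBy-inverse a b ab≈1) (mulBy-inverse b a ba≈1)
    where
    b = proj₁ (modular-inverse a⊥N)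
    ab≈1 = proj₂ (modular-inverse a⊥N)
    ba≈1 = subst (λ z → z ≈ 1 ⟨mod N ⟩) (*-comm a b) ab≈1

  euler : ∀ {a} → Coprime a N → a ^ φ N ≈ 1 ⟨mod N ⟩
  euler {a} a⊥N = ≈-*-cancelʳ (∏-coprime N (unit ∘ toℕ) (unit-coprime ∘ toℕ)) (begin
    a ^ φ N * P                                 ≡⟨ cong (λ e → a ^ e * P) φ≡∑ι ⟩
    a ^ sum (applyUpTo ι N) * P                 ≡⟨ ∏-pow a ι unit N ⟨
    ∏ {N} (λ i → a ^ ι (toℕ i) * unit (toℕ i))  ≡⟨ ∏-cong {N} (λ i → ^-distribʳ-* a (toℕ i) (ι (toℕ i))) ⟨
    ∏ {N} (λ i → (a * toℕ i) ^ ι (toℕ i))       ≈⟨ ∏-≈ N _ _ (λ i → reduce (toℕ i)) ⟩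
    ∏ {N} (λ i → unit (toℕ (mulBy a i)))        ≡⟨ ∏-permute (unit ∘ toℕ) (mulBy-permutation a⊥N) ⟨
    P                                           ≡⟨ *-identityˡ P ⟨
    1 * P                                       ∎)
    where
    open ≈-Reasoning N
    P = ∏ {N} (unit ∘ toℕ)
    reduce : ∀ k → (a * k) ^ ι k ≈ unit (toℕ (fromℕ< (m%n<n (a * k) N))) ⟨mod N ⟩
    reduce k = begin
      (a * k) ^ ι k            ≡⟨ cong ((a * k) ^_) (trans (sym (ι-*ˡ a k a⊥N)) (ι-≈ (≈-sym (%-≈ (a * k))))) ⟩
      (a * k) ^ ι (a * k % N)  ≈⟨ ≈-^ (ι (a * k % N)) (≈-sym (%-≈ (a * k))) ⟩
      unit (a * k % N)         ≡⟨ cong unit (toℕ-fromℕ< (m%n<n (a * k) N)) ⟨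
      unit (toℕ (fromℕ< (m%n<n (a * k) N))) ∎

IsUnitExponent : ℕ → ℕ → Set
IsUnitExponent N k = ∀ a → Coprime a N → a ^ k ≈ 1 ⟨mod N ⟩

module _ {N : ℕ} .{{_ : NonZero N}} where

  killsUnits⇒unitExponent : ∀ {k} → KillsUnits N k → IsUnitExponent N k
  killsUnits⇒unitExponent kills a a⊥N = %⇒≈ (kills a a⊥N)

  unitExponent⇒killsUnits : ∀ {k} → IsUnitExponent N k → KillsUnits N k
  unitExponent⇒killsUnits kexp a a⊥N = ≈⇒% (kexp a a⊥N)

  φ-unitExponent : IsUnitExponent N (φ N)
  φ-unitExponent a = Euler.euler

unitExponent-* : ∀ {N k} c → IsUnitExponent N k → IsUnitExponent N (c * k)
unitExponent-* {N} {k} c kexp a a⊥N = begin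
  a ^ (c * k)   ≡⟨ cong (a ^_) (*-comm c k) ⟩
  a ^ (k * c)   ≡⟨ ^-*-assoc a k c ⟨
  (a ^ k) ^ c   ≈⟨ ≈-^ c (kexp a a⊥N) ⟩
  1 ^ c         ≡⟨ ^-zeroˡ c ⟩
  1             ∎
  where open ≈-Reasoning N

-- λ(N) divides every unit exponent k: the remainder of k modulo
-- λ(N) is again a unit exponent, so by minimality it is 0.
carmichael-∣ : ∀ {N L k} .{{_ : NonZero N}} → IsCarmichael N L →
               IsUnitExponent N k → L ∣ k
carmichael-∣ {N} {L} {k} (1≤L , L-kills , L-minimal) kexp = m%n≡0⇒n∣m k L k%L≡0
  where
  instance
    L≢0 : NonZero L
    L≢0 = >-nonZero 1≤L
  L-exponent : IsUnitExponent N L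
  L-exponent = killsUnits⇒unitExponent {k = L} L-kills
  rem-exp : IsUnitExponent N (k % L)
  rem-exp a a⊥N = begin
    a ^ (k % L)                        ≡⟨ *-identityʳ _ ⟨
    a ^ (k % L) * 1                    ≈⟨ ≈-*ˡ (a ^ (k % L)) (unitExponent-* (k / L) L-exponent a a⊥N) ⟨
    a ^ (k % L) * a ^ (k / L * L)      ≡⟨ ^-distribˡ-+-* a (k % L) _ ⟨
    a ^ (k % L + k / L * L)            ≡⟨ cong (a ^_) (m≡m%n+[m/n]*n k L) ⟨
    a ^ k                              ≈⟨ kexp a a⊥N ⟩
    1                                  ∎
    where open ≈-Reasoning N
  k%L≡0 : k % L ≡ 0
  k%L≡0 with k % L ≟ 0
  ... | yes k%L≡0 = k%L≡0
  ... | no  k%L≢0 = ⊥-elim (<⇒≱ (m%n<n k L)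
                      (L-minimal (k % L) (n≢0⇒n>0 k%L≢0) (unitExponent⇒killsUnits {k = k % L} rem-exp)))

-- φ(N) ≥ 1, since 1 is coprime to N: the filter defining φ keeps 1.
φ-pos : ∀ N .{{_ : NonZero N}} → 1 ≤ φ N
φ-pos (suc m) rewrite filter-accept (λ k → coprime? k (suc m)) {xs = applyUpTo (suc ∘ suc) m} (1-coprimeTo (suc m)) = s≤s z≤n

binomial-mod-square : ∀ y n → (1 + y) ^ n ≈ 1 + n * y ⟨mod y * y ⟩
binomial-mod-square y zero    = ≈-refl
binomial-mod-square y (suc n) = begin
  (1 + y) * (1 + y) ^ n              ≈⟨ ≈-*ˡ (1 + y) (binomial-mod-square y n) ⟩
  (1 + y) * (1 + n * y)              ≡⟨ expand ⟩
  1 + suc n * y + n * (y * y)        ≈⟨ ≈-+ (≈-refl {x = 1 + suc n * y}) (∣⇒≈0 (n∣m*n n)) ⟩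
  1 + suc n * y + 0                  ≡⟨ +-identityʳ _ ⟩
  1 + suc n * y                      ∎
  where
  open ≈-Reasoning (y * y)
  expand : (1 + y) * (1 + n * y) ≡ 1 + suc n * y + n * (y * y)
  expand = solve (y ∷ n ∷ [])

-- Writing
-- N = m·d² and y = m·d, the number 1 + y is a unit and N ∣ y², so
-- 1 ≡ (1 + y)^k ≡ 1 + k·y (mod N); hence d·y = N divides k·y.
square-divisor : ∀ {N k d} .{{_ : NonZero N}} → IsUnitExponent N k → d * d ∣ N → d ∣ k
square-divisor {N} {k} {d} kexp (divides m N≡m*dd) =
  *-cancelʳ-∣ y {{y≢0}} (subst (_∣ k * y) (trans N≡m*dd (rearrange m d)) N∣ky)
  where
  y = m * d
  rearrange : ∀ m d → m * (d * d) ≡ d * (m * d)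
  rearrange = solve-∀
  y≢0 : NonZero y
  y≢0 = ≢-nonZero λ y≡0 → ≢-nonZero⁻¹ N (trans N≡m*dd (trans (rearrange m d) (trans (cong (d *_) y≡0) (*-zeroʳ d))))
  N∣yy : N ∣ y * y
  N∣yy = divides m (trans (square m d) (cong (m *_) (sym N≡m*dd)))
    where
    square : ∀ m d → m * d * (m * d) ≡ m * (m * (d * d))
    square = solve-∀
  1+y⊥N : Coprime (1 + y) N
  1+y⊥N = coprime-∣ʳ (coprime-*ʳ (coprime-suc y) (coprime-suc y)) N∣yy
  N∣ky : N ∣ k * y
  N∣ky = ≈0⇒∣ (≈-+-cancelˡ 1 (begin
    1 + k * y   ≈⟨ ≈-divisor N∣yy (binomial-mod-square y k) ⟨
    (1 + y) ^ k ≈⟨ kexp (1 + y) 1+y⊥N ⟩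
    1           ∎))
    where open ≈-Reasoning N

-- 4 is never a unit exponent of a multiple N = 32·M of 32: the unit
-- 1 + 4M has (1 + 4M)^4 ≡ 1 + 16M (mod N), and N ∤ 16M.
no-exponent-4 : ∀ {N} .{{_ : NonZero N}} → IsUnitExponent N 4 → 32 ∣ N → ⊥
no-exponent-4 {N} kexp (divides M N≡M*32) = 2≢1 (∣1⇒≡1 (*-cancelʳ-∣ (16 * M) {{16M≢0}} N∣16M′))
  where
  2≢1 : 2 ≢ 1
  2≢1 ()
  y = 4 * M
  M≢0 : NonZero M
  M≢0 = ≢-nonZero λ M≡0 → ≢-nonZero⁻¹ N (trans N≡M*32 (cong (_* 32) M≡0))
  16M≢0 : NonZero (16 * M)
  16M≢0 = m*n≢0 16 M {{_}} {{M≢0}}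
  N≡2*16M : N ≡ 2 * (16 * M)
  N≡2*16M = trans N≡M*32 (double M)
    where
    double : ∀ M → M * 32 ≡ 2 * (16 * M)
    double = solve-∀
  N∣2yy : N ∣ 2 * (y * y)
  N∣2yy = divides M (trans (twice-square M) (cong (M *_) (sym N≡M*32)))
    where
    twice-square : ∀ M → 2 * (4 * M * (4 * M)) ≡ M * (M * 32)
    twice-square = solve-∀
  1+y-odd : 1 + 2 * (2 * M) ≡ 1 + y
  1+y-odd = cong suc (sym (*-assoc 2 2 M))
  1+y⊥N : Coprime (1 + y) N
  1+y⊥N = coprime-∣ʳ (coprime-*ʳ (subst (λ z → Coprime z 2) 1+y-odd (coprime-odd (2 * M)))
                                  (coprime-*ʳ (coprime-suc y) (coprime-suc y))) N∣2yy
  expand : ∀ M → (1 + 4 * M) * ((1 + 4 * M) * ((1 + 4 * M) * ((1 + 4 * M) * 1))) ≡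
                 1 + 16 * M + (3 * M + 8 * M * M + 8 * M * M * M) * (M * 32)
  expand = solve-∀
  c = 3 * M + 8 * M * M + 8 * M * M * M
  fourth-power : (1 + y) ^ 4 + 0 * N ≡ 1 + 16 * M + c * N
  fourth-power = trans (trans (+-identityʳ _) (expand M)) (cong (λ n → 1 + 16 * M + c * n) (sym N≡M*32))
  N∣16M : N ∣ 16 * M
  N∣16M = ≈0⇒∣ (≈-+-cancelˡ 1 (≈-trans (≈-sym (0 , c , fourth-power)) (kexp (1 + y) 1+y⊥N)))
  N∣16M′ : 2 * (16 * M) ∣ 1 * (16 * M)
  N∣16M′ = subst₂ _∣_ N≡2*16M (sym (*-identityˡ (16 * M))) N∣16M

^-monoʳ-∣ : ∀ i {m n} → m ≤ n → i ^ m ∣ i ^ n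
^-monoʳ-∣ i {m} m≤n with o , refl ← m≤n⇒∃[o]m+o≡n m≤n =
  divides (i ^ o) (trans (^-distribˡ-+-* i m o) (*-comm (i ^ m) (i ^ o)))

^-monoˡ-∣ : ∀ {a b} k → a ∣ b → a ^ k ∣ b ^ k
^-monoˡ-∣ zero    a∣b = ∣-refl
^-monoˡ-∣ (suc k) a∣b = *-pres-∣ a∣b (^-monoˡ-∣ k a∣b)

^-double : ∀ i m → i ^ (2 * m) ≡ i ^ m * i ^ m
^-double i m = trans (cong (λ n → i ^ (m + n)) (+-identityʳ m)) (^-distribˡ-+-* i m m)

PowerFree : ℕ → ℕ → Set
PowerFree s N = ∀ i → 2 ≤ i → i ^ s ∣ N → ⊥

half-exponent-step : ∀ {e m} → 1 ≤ e → 2 * m ≤ suc e → e < 2 ^ m →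
                     2 * suc m ≤ suc (suc (suc e)) × suc (suc e) < 2 ^ suc m
half-exponent-step {e} {m} 1≤e 2m≤1+e e<2^m =
  subst (_≤ 3 + e) (sym (*-distribˡ-+ 2 1 m)) (s≤s (s≤s 2m≤1+e)) ,
  (begin
    2 + (1 + e)              ≤⟨ +-monoʳ-≤ 2 (+-monoˡ-≤ e 1≤e) ⟩
    2 + (e + e)              ≡⟨ regroup e ⟩
    (1 + e) + ((1 + e) + 0)  ≤⟨ +-mono-≤ e<2^m (+-monoˡ-≤ 0 e<2^m) ⟩
    2 ^ m + (2 ^ m + 0)      ∎)
  where
  open ≤-Reasoning
  regroup : ∀ e → 2 + (e + e) ≡ (1 + e) + ((1 + e) + 0)
  regroup = solve-∀

-- Apart from e = 2 and e = 4, every e admits m with 2m ≤ e + 1 and e < 2^m;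
-- then a factor i^(e+1) contains the square (i^m)², with i^m ≥ 2^m > e.
half-exponent : ∀ e → e ≢ 2 → e ≢ 4 → ∃ λ m → 2 * m ≤ suc e × e < 2 ^ m
half-exponent 0 _   _   = 0 , z≤n , ≤-refl
half-exponent 1 _   _   = 1 , ≤-refl , ≤-refl
half-exponent 2 e≢2 _   = ⊥-elim (e≢2 refl)
half-exponent 3 _   _   = 2 , ≤-refl , ≤-refl
half-exponent 4 _   e≢4 = ⊥-elim (e≢4 refl)
half-exponent 5 _   _   = 3 , ≤-refl , ≤ᵇ⇒≤ 6 8 _
half-exponent 6 _   _   = 3 , ≤ᵇ⇒≤ 6 7 _ , ≤ᵇ⇒≤ 7 8 _
half-exponent (suc (suc e@(suc (suc (suc (suc (suc _))))))) _ _
  with m , 2m≤1+e , e<2^m ← half-exponent e (λ ()) (λ ())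
  = suc m , half-exponent-step (s≤s z≤n) 2m≤1+e e<2^m

-- A factor i^(e+1) of N with i ≥ 2 and
-- e ≥ k is impossible, except for e = k = 2 with 8 ∣ N: squares dividing N
-- divide k, and half-exponent turns this into i^m ≤ k ≤ e < 2^m ≤ i^m.
module PowerFactors {N k : ℕ} .{{_ : NonZero N}} (kexp : IsUnitExponent N k) (1≤k : 1 ≤ k) where

  instance
    k≢0 : NonZero k
    k≢0 = >-nonZero 1≤k

  power-∣-exponent : ∀ {i e} m → 2 * m ≤ suc e → i ^ suc e ∣ N → i ^ m ∣ k
  power-∣-exponent {i} m 2m≤1+e i^[1+e]∣N =
    square-divisor kexp (subst (_∣ N) (^-double i m) (∣-trans (^-monoʳ-∣ i 2m≤1+e) i^[1+e]∣N))

  exceptional : ∀ {e i} → k ≤ e → 2 ≤ i → i ^ suc e ∣ N → e ≡ 2 × k ≡ 2 × 8 ∣ N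
  exceptional {e} {i} k≤e 2≤i i^[1+e]∣N with e ≟ 2 | e ≟ 4
  ... | yes refl | _ = refl , k≡2 , subst (λ j → j ^ 3 ∣ N) i≡2 i^[1+e]∣N
    where
    i≤k : i ≤ k
    i≤k = ∣⇒≤ (subst (_∣ k) (*-identityʳ i) (power-∣-exponent {i} 1 (≤ᵇ⇒≤ 2 3 _) i^[1+e]∣N))
    k≡2 : k ≡ 2
    k≡2 = ≤-antisym k≤e (≤-trans 2≤i i≤k)
    i≡2 : i ≡ 2
    i≡2 = ≤-antisym (≤-trans i≤k k≤e) 2≤i
  ... | no _ | yes refl =
    ⊥-elim (no-exponent-4 (subst (IsUnitExponent N) k≡4 kexp) (subst (λ j → j ^ 5 ∣ N) i≡2 i^[1+e]∣N))
    where
    ii≤k : i * i ≤ k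
    ii≤k = ∣⇒≤ (subst (λ j → i * j ∣ k) (*-identityʳ i) (power-∣-exponent {i} 2 (≤ᵇ⇒≤ 4 5 _) i^[1+e]∣N))
    i≡2 : i ≡ 2
    i≡2 = ≤-antisym (≮⇒≥ λ 2<i → <⇒≱ (*-mono-< 2<i 2<i) (≤-trans ii≤k k≤e)) 2≤i
    k≡4 : k ≡ 4
    k≡4 = ≤-antisym k≤e (subst (λ j → j * j ≤ k) i≡2 ii≤k)
  ... | no e≢2 | no e≢4 with m , 2m≤1+e , e<2^m ← half-exponent e e≢2 e≢4 =
    ⊥-elim (<⇒≱ e<2^m (begin
      2 ^ m  ≤⟨ ^-monoˡ-≤ m 2≤i ⟩
      i ^ m  ≤⟨ ∣⇒≤ (power-∣-exponent m 2m≤1+e i^[1+e]∣N) ⟩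
      k      ≤⟨ k≤e ⟩
      e      ∎))
    where open ≤-Reasoning

-- Write g = gcd(N, j^e) and N = N′·g.
-- A common factor t ≥ 2 of N′ and j would give t^(e+1) ∣ N, so N′ ⊥ j.
-- Then j + N′ is a unit modulo N that is congruent to j modulo N′, so
-- j^k ≡ 1 (mod N′); multiplying by j^e, a multiple of g, gives the claim.
module Periodicity {N e k : ℕ} .{{_ : NonZero N}} (free : PowerFree (suc e) N)
                   (kexp : IsUnitExponent N k) (j : ℕ) where

  g : ℕ
  g = gcd N (j ^ e)

  g∣j^e : g ∣ j ^ e
  g∣j^e = gcd[m,n]∣n N (j ^ e)

  N′ : ℕ
  N′ = quotient (gcd[m,n]∣m N (j ^ e))

  N≡N′g : N ≡ N′ * g
  N≡N′g = _∣_.equality (gcd[m,n]∣m N (j ^ e))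

  -- Powers t^n (n ≤ e + 1) of a common factor t of N′ and j divide N:
  -- t^(n−1) divides both N and j^e, hence g, and t divides N′.
  common-factor-powers : ∀ {t} → t ∣ N′ → t ∣ j → ∀ n → n ≤ suc e → t ^ n ∣ N
  common-factor-powers t∣N′ t∣j zero    _       = 1∣ N
  common-factor-powers {t} t∣N′ t∣j (suc n) 1+n≤1+e =
    subst (t ^ suc n ∣_) (sym N≡N′g) (*-pres-∣ t∣N′ (gcd-greatest t^n∣N t^n∣j^e))
    where
    t^n∣N : t ^ n ∣ N
    t^n∣N = common-factor-powers t∣N′ t∣j n (≤-trans (n≤1+n n) 1+n≤1+e)
    t^n∣j^e : t ^ n ∣ j ^ e
    t^n∣j^e = ∣-trans (^-monoˡ-∣ n t∣j) (^-monoʳ-∣ j (s≤s⁻¹ 1+n≤1+e))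

  N′⊥j : Coprime N′ j
  N′⊥j {zero} (0∣N′ , _) = ⊥-elim (≢-nonZero⁻¹ N (trans N≡N′g (cong (_* g) (0∣⇒≡0 0∣N′))))
  N′⊥j {suc zero} _ = refl
  N′⊥j {t@(suc (suc _))} (t∣N′ , t∣j) =
    ⊥-elim (free t (s≤s (s≤s z≤n)) (common-factor-powers t∣N′ t∣j (suc e) ≤-refl))

  j+N′⊥N : Coprime (j + N′) N
  j+N′⊥N = subst (Coprime (j + N′)) (sym N≡N′g) (coprime-*ʳ ⊥N′ (coprime-∣ʳ (coprime-^ʳ e ⊥j) g∣j^e))
    where
    ⊥N′ : Coprime (j + N′) N′
    ⊥N′ {t} (t∣j+N′ , t∣N′) = N′⊥j (t∣N′ , ∣m+n∣m⇒∣n (subst (t ∣_) (+-comm j N′) t∣j+N′) t∣N′)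
    ⊥j : Coprime (j + N′) j
    ⊥j (t∣j+N′ , t∣j) = N′⊥j (∣m+n∣m⇒∣n t∣j+N′ t∣j , t∣j)

  j^k≈1 : j ^ k ≈ 1 ⟨mod N′ ⟩
  j^k≈1 = ≈-trans (≈-^ k (≈-sym j+N′≈j)) (≈-divisor N′∣N (kexp (j + N′) j+N′⊥N))
    where
    j+N′≈j : j + N′ ≈ j ⟨mod N′ ⟩
    j+N′≈j = 0 , 1 , trans (+-identityʳ (j + N′)) (cong (j +_) (sym (*-identityˡ N′)))
    N′∣N : N′ ∣ N
    N′∣N = divides g (trans N≡N′g (*-comm N′ g))

  periodic : j ^ (e + k) ≈ j ^ e ⟨mod N ⟩
  periodic = subst (λ n → j ^ (e + k) ≈ j ^ e ⟨mod n ⟩) (trans (*-comm g N′) (sym N≡N′g)) (begin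
    j ^ (e + k)        ≡⟨ ^-distribˡ-+-* j e k ⟩
    j ^ e * j ^ k      ≡⟨ cong (_* j ^ k) j^e≡wg ⟩
    w * g * j ^ k      ≡⟨ *-assoc w g (j ^ k) ⟩
    w * (g * j ^ k)    ≈⟨ ≈-*ˡ w (≈-scale g j^k≈1) ⟩
    w * (g * 1)        ≡⟨ cong (w *_) (*-identityʳ g) ⟩
    w * g              ≡⟨ j^e≡wg ⟨
    j ^ e              ∎)
    where
    open ≈-Reasoning (g * N′)
    w = quotient g∣j^e
    j^e≡wg : j ^ e ≡ w * g
    j^e≡wg = _∣_.equality g∣j^e

parity : ∀ q → (∃ λ r → q ≡ 2 * r) ⊎ (∃ λ r → q ≡ 1 + 2 * r)
parity zero    = inj₁ (0 , refl)
parity (suc q) with parity q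
... | inj₁ (r , refl) = inj₂ (r , refl)
... | inj₂ (r , refl) = inj₁ (suc r , cong suc (sym (+-suc r (r + 0))))

-- If 2 is a unit exponent of a multiple N = 8q of 8, then N is 8 or 24:
-- q cannot be even, since 4² ∣ N would force 4 ∣ 2; for odd q = M the
-- unit M + 2 satisfies 1 ≡ (M + 2)² ≡ 4 (mod M), so M ∣ 3.
exponent-2 : ∀ {N} .{{_ : NonZero N}} → IsUnitExponent N 2 → 8 ∣ N → N ≡ 8 ⊎ N ≡ 24
exponent-2 {N} kexp (divides q N≡q*8) with parity q
... | inj₁ (r , refl) = ⊥-elim (4≰2 (∣⇒≤ (square-divisor kexp (divides r (trans N≡q*8 (regroup r))))))
  where
  4≰2 : 4 ≤ 2 → ⊥
  4≰2 (s≤s (s≤s ()))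
  regroup : ∀ r → 2 * r * 8 ≡ r * (4 * 4)
  regroup = solve-∀
... | inj₂ (r , refl) = small-odd r N≡q*8 M∣3
  where
  M = 1 + 2 * r
  a = 2 + M
  a⊥M : Coprime a M
  a⊥M {t} (t∣a , t∣M) = coprime-odd r (t∣M , ∣m+n∣m⇒∣n (subst (t ∣_) (+-comm 2 M) t∣a) t∣M)
  a⊥8 : Coprime a 8
  a⊥8 = coprime-^ʳ 3 (subst (λ z → Coprime z 2) (odd r) (coprime-odd (1 + r)))
    where
    odd : ∀ r → 1 + 2 * (1 + r) ≡ 2 + (1 + 2 * r)
    odd = solve-∀
  a⊥N : Coprime a N
  a⊥N = subst (Coprime a) (sym N≡q*8) (coprime-*ʳ a⊥M a⊥8)
  M∣3 : M ∣ 3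
  M∣3 = ≈0⇒∣ (≈-+-cancelˡ 1 (begin
    4                    ≈⟨ ≈-sym (0 , 4 + M , +-identityʳ _) ⟩
    4 + (4 + M) * M      ≡⟨ square M ⟨
    a ^ 2                ≈⟨ ≈-divisor (divides 8 (trans N≡q*8 (*-comm M 8))) (kexp a a⊥N) ⟩
    1                    ∎))
    where
    open ≈-Reasoning M
    square : ∀ M → (2 + M) * ((2 + M) * 1) ≡ 4 + (4 + M) * M
    square = solve-∀
  small-odd : ∀ r → N ≡ (1 + 2 * r) * 8 → 1 + 2 * r ∣ 3 → N ≡ 8 ⊎ N ≡ 24
  small-odd 0 N≡8 _ = inj₁ N≡8
  small-odd 1 N≡24 _ = inj₂ N≡24
  small-odd (suc (suc r)) _ M∣3 = ⊥-elim (<⇒≱ (≤ᵇ⇒≤ 4 5 _) (begin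
    5                  ≤⟨ m≤m+n 5 (2 * r) ⟩
    5 + 2 * r          ≡⟨ five r ⟩
    1 + 2 * (2 + r)    ≤⟨ ∣⇒≤ M∣3 ⟩
    3                  ∎))
    where
    open ≤-Reasoning
    five : ∀ r → 5 + 2 * r ≡ 1 + 2 * (2 + r)
    five = solve-∀

small-moduli : ∀ {N} .{{_ : NonZero N}} → N ≡ 8 ⊎ N ≡ 24 →
               sumTo (N ∸ 1) (λ j → j ^ 2) ≡ sumTo (N ∸ 1) (λ j → j ^ 4) [mod N ]
small-moduli (inj₁ refl) = refl
small-moduli (inj₂ refl) = refl

module PowerSums {N L : ℕ} .{{_ : NonZero N}} (carmichael : IsCarmichael N L) where

  S : ℕ → ℕ
  S e = sumTo (N ∸ 1) (λ j → j ^ e)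

  1≤L : 1 ≤ L
  1≤L = proj₁ carmichael

  L-exponent : IsUnitExponent N L
  L-exponent = killsUnits⇒unitExponent {k = L} (proj₁ (proj₂ carmichael))

  open PowerFactors L-exponent 1≤L

  S-periodic : ∀ e → PowerFree (suc e) N → ∀ c → S (e + c * L) ≈ S e ⟨mod N ⟩
  S-periodic e free c =
    ≈-sum _ _ (Periodicity.periodic {e = e} {k = c * L} free (unitExponent-* c L-exponent)) (oneTo (N ∸ 1))

  Exceptional : ℕ → Set
  Exceptional A = A ≡ 1 × L ≡ 2 × 8 ∣ N

  powerFree : ∀ A → 1 ≤ A → ¬ Exceptional A → PowerFree (suc (A * L)) N
  powerFree A@(suc A′) _ ¬exc i 2≤i i^[1+AL]∣N with exceptional (m≤m+n L (A′ * L)) 2≤i i^[1+AL]∣N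
  ... | AL≡2 , L≡2 , 8∣N = ¬exc (*-cancelʳ-≡ A 1 2 (trans (cong (A *_) (sym L≡2)) AL≡2) , L≡2 , 8∣N)

  S-constant : ∀ A → 1 ≤ A → S (A * L) ≈ S (2 * L) ⟨mod N ⟩
  S-constant A 1≤A with (A ≟ 1) ×-dec (L ≟ 2) ×-dec (8 ∣? N)
  ... | yes (refl , L≡2 , 8∣N) =
    subst (λ l → S (1 * l) ≈ S (2 * l) ⟨mod N ⟩) (sym L≡2)
          (%⇒≈ (small-moduli (exponent-2 (subst (IsUnitExponent N) L≡2 L-exponent) 8∣N)))
  ... | no ¬exc = begin
    S (A * L)            ≈⟨ S-periodic (A * L) (powerFree A 1≤A ¬exc) 2 ⟨
    S (A * L + 2 * L)    ≡⟨ cong S (+-comm (A * L) (2 * L)) ⟩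
    S (2 * L + A * L)    ≈⟨ S-periodic (2 * L) (powerFree 2 (s≤s z≤n) 2≢1) A ⟩
    S (2 * L)            ∎
    where
    open ≈-Reasoning N
    2≢1 : ¬ Exceptional 2
    2≢1 (() , _)

factor-pos : ∀ m {n} → 1 ≤ m * n → 1 ≤ m
factor-pos (suc m) _ = s≤s z≤n

proposition3 : (A B N : ℕ) → 1 ≤ A → 1 ≤ B → .{{_ : NonZero N}} →
    (L : ℕ) → IsCarmichael N L →
    sumTo (N ∸ 1) (λ j → j ^ (A * L)) ≡ sumTo (N ∸ 1) (λ j → j ^ (B * φ N)) [mod N ]
proposition3 A B N 1≤A 1≤B L carmichael = ≈⇒% (begin
  S (A * L)      ≈⟨ S-constant A 1≤A ⟩
  S (2 * L)      ≈⟨ S-constant q 1≤q ⟨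
  S (q * L)      ≡⟨ cong S Bφ≡qL ⟨
  S (B * φ N)    ∎)
  where
  open PowerSums carmichael
  open ≈-Reasoning N
  L∣Bφ : L ∣ B * φ N
  L∣Bφ = carmichael-∣ carmichael (unitExponent-* B φ-unitExponent)
  q = quotient L∣Bφ
  Bφ≡qL : B * φ N ≡ q * L
  Bφ≡qL = _∣_.equality L∣Bφ
  1≤q : 1 ≤ q
  1≤q = factor-pos q (subst (1 ≤_) Bφ≡qL (*-mono-≤ 1≤B (φ-pos N)))
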